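{- For every prime $p\geq 11$, $$P(p,3)\leq (p-1)!-\left\lceil \tfrac{p}{3}\right\rceil+2\leq (p-1)!-2 .$$
   Context: $S_n$ denotes the set of all permutations of $[n]=\{1,\dots,n\}$. For $\rho,\pi\in S_n$, the Kendall $\tau$-distance $d_K(\rho,\pi)$ is the minimum number of adjacent transpositions $(i,i+1)$, $1\leq i\leq n-1$, whose product equals $\rho\pi^{ -1}$ (equivalently, the graph distance between $\rho$ and $\pi$ in the Cayley graph of $S_n$ with respect to the set of adjacent transpositions). A permutation code of length $n$ is a non-empty subset of $S_n$. $P(n,d)$ denotes the maximum size of a permutation code $C\subseteq S_n$ such that $d_K(x,y)\geq d$ for all distinct $x,y\in C$. -}

module Defs where

open import Data.Nat using (ℕ; zero; suc; _<_; _≤_)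
open import Data.Fin using (Fin)
open import Data.Vec using (Vec; []; _∷_)
open import Data.List using (List; length)
open import Data.Vec.Relation.Unary.Unique.Propositional using (Unique)
open import Data.List.Relation.Unary.All using (All)
open import Data.List.Relation.Unary.AllPairs using (AllPairs)
open import Relation.Nullary using (¬_)
open import Data.Product using (_×_)

-- A permutation of [n] in one-line notation: a vector of length n over Fin n
-- with pairwise distinct entries.
IsPerm : (n : ℕ) → Vec (Fin n) n → Set
IsPerm n v = Unique v

data AdjSwap {A : Set} : {m : ℕ} → Vec A m → Vec A m → Set where
  here  : ∀ {m} (x y : A) (xs : Vec A m) → AdjSwap (x ∷ y ∷ xs) (y ∷ x ∷ xs)
  there : ∀ {m} (x : A) {xs ys : Vec A m} → AdjSwap xs ys → AdjSwap (x ∷ xs) (x ∷ ys)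

data Steps {A : Set} {m : ℕ} : ℕ → Vec A m → Vec A m → Set where
  done : ∀ {u} → Steps zero u u
  step : ∀ {k u v w} → AdjSwap u v → Steps k v w → Steps (suc k) u w

-- Kendall tau-distance at least d: no path of fewer than d adjacent
-- transpositions in the Cayley graph connects the two permutations.
KendallAtLeast : {n : ℕ} → ℕ → Vec (Fin n) n → Vec (Fin n) n → Set
KendallAtLeast d x y = ∀ k → k < d → ¬ Steps k x y

-- A permutation code of length n with minimum Kendall distance d, given as a
-- duplicate-free list of its codewords.
IsCode : (n d : ℕ) → List (Vec (Fin n) n) → Set
IsCode n d C = All (IsPerm n) C × AllPairs (λ x y → KendallAtLeast d x y) C

P≤ : ℕ → ℕ → ℕ → Set
P≤ n d M = ∀ (C : List (Vec (Fin n) n)) → IsCode n d C → length C ≤ M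

-- Let p be prime, N = (p-1)! and C a code in S_p with minimum Kendall distance 3.
-- The balls of radius one around the codewords are pairwise disjoint.  Sort
-- permutations by the position of the symbol 0: exactly N of them have 0 at a given
-- position j, and the ball around a codeword with 0 at position q contains [q = j]
-- plus (number of adjacent transpositions moving q to j) of these.  Writing a(j) for
-- the number of codewords with 0 at position j, this yields the row inequalities
--   a(j-1) + a(j+1) + (p-2)·a(j) ≤ N        (neighbours clamped to 0 … p-1).
-- By Wilson's theorem N + 1 = p·m, so every row, having total weight p, falls short
-- of p·m.  Measuring a against the average m, row j forces the deficit m - a to be at
-- least 1 + 3·max(a(j) - m, 0) on the three positions j-1, j, j+1; summing over j
-- gives 3|C| + p ≤ 3(N + 1), i.e. |C| ≤ N + 1 - ⌈p/3⌉.

module Submission where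

open import Defs
open import Data.Nat
open import Data.Nat.Properties
open import Data.Nat.DivMod
open import Data.Nat.Divisibility
open import Data.Nat.Primality
open import Data.Nat.Coprimality using (coprime-Bézout; prime⇒coprime)
open import Data.Nat.GCD using (module Bézout)
open import Data.Nat.ListAction using (product)
open import Data.Nat.ListAction.Properties using (product-↭)
open import Data.Nat.Tactic.RingSolver using (solve-∀)
open import Algebra.Properties.CommutativeSemigroup +-commutativeSemigroup
  using () renaming (interchange to +-interchange; x∙yz≈y∙xz to +-left-comm)
open import Data.Bool using (true; false; if_then_else_)
open import Data.Product using (_×_; ∃; _,_; proj₁; proj₂)
open import Data.Sum using (_⊎_; inj₁; inj₂)
open import Data.Empty using (⊥-elim)
open import Function using (_∘_; id)
open import Relation.Nullary using (¬_; Dec; yes; no; does; ¬?)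
open import Relation.Nullary.Decidable using (dec-true; dec-false)
open import Relation.Unary using (Decidable)
open import Relation.Binary.Definitions using (DecidableEquality; tri<; tri≈; tri>)
open import Relation.Binary.PropositionalEquality

open import Data.List
  using (List; []; _∷_; _++_; length; map; filter; concatMap; tabulate; applyDownFrom; downFrom)
open import Data.List.Properties
  using (length-map; filter-all; length-downFrom; length-tabulate; length-applyDownFrom)
open import Data.List.Membership.Propositional using (_∈_; _∉_)
open import Data.List.Membership.Propositional.Properties
  using ( ∈-∃++; ∈-applyDownFrom⁺; ∈-applyDownFrom⁻; ∈-filter⁺; ∈-downFrom⁺; ∈-downFrom⁻
        ; ∈-map⁻; ∈-tabulate⁺)
open import Data.List.Relation.Unary.Any using (here; there)
open import Data.List.Relation.Unary.All as All using (All; []; _∷_)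
import Data.List.Relation.Unary.All.Properties as All
open import Data.List.Relation.Unary.All.Properties using (all-filter)
open import Data.List.Relation.Unary.AllPairs using ([]; _∷_)
import Data.List.Relation.Unary.AllPairs as AllPairs
import Data.List.Relation.Unary.AllPairs.Properties as AllPairs
open import Data.List.Relation.Unary.Unique.Propositional using (Unique)
import Data.List.Relation.Unary.Unique.Propositional.Properties as Unique
open import Data.List.Relation.Unary.Unique.Propositional.Properties
  using (Unique[x∷xs]⇒x∉xs; applyDownFrom⁺₁)
open import Data.List.Relation.Binary.Disjoint.Propositional using (Disjoint)
open import Data.List.Relation.Binary.Permutation.Propositional using (_↭_; ↭-sym; ↭⇒↭ₛ)
open import Data.List.Relation.Binary.Permutation.Propositional.Properties
  using (shift; ∈-resp-↭; ↭-length)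
import Data.List.Relation.Binary.Permutation.Setoid.Properties as ↭ₛ

open import Data.Vec using (Vec; []; _∷_; head; tail)
open import Data.Vec.Properties using (∷-injectiveˡ; ∷-injectiveʳ)
import Data.Vec.Relation.Unary.All as VecAll
open import Data.Vec.Relation.Unary.All using ([]; _∷_)
open import Data.Vec.Relation.Unary.AllPairs using ([]; _∷_)
import Data.Vec.Relation.Unary.Unique.Propositional as VecUnique
open import Data.Fin as Fin using (Fin)
import Data.Fin.Properties as Fin

-- Lists, indicators and finite sums

Unique-resp-↭ : ∀ {A : Set} {xs ys : List A} → xs ↭ ys → Unique xs → Unique ys
Unique-resp-↭ {A} xs↭ys = ↭ₛ.Unique-resp-↭ (setoid A) (↭⇒↭ₛ xs↭ys)

Unique-map⁺-on : ∀ {A B : Set} {P : A → Set} (f : A → B) →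
  (∀ {x y} → P x → P y → f x ≡ f y → x ≡ y) → ∀ {xs} → All P xs → Unique xs → Unique (map f xs)
Unique-map⁺-on f inj []         []           = []
Unique-map⁺-on {P = P} f inj {x ∷ _} (px ∷ pxs) (x∉xs ∷ uxs) =
  images-differ pxs x∉xs ∷ Unique-map⁺-on f inj pxs uxs
  where
  images-differ : ∀ {ys} → All P ys → All (x ≢_) ys → All (f x ≢_) (map f ys)
  images-differ []         []           = []
  images-differ (py ∷ pys) (x≢y ∷ x∉ys) = (x≢y ∘ inj px py) ∷ images-differ pys x∉ys

length-filter-∁ : ∀ {A : Set} {P : A → Set} (P? : Decidable P) xs →
  length xs ≡ length (filter P? xs) + length (filter (¬? ∘ P?) xs)
length-filter-∁ P? []       = refl
length-filter-∁ P? (x ∷ xs) with P? x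
... | yes _ = cong suc (length-filter-∁ P? xs)
... | no  _ = trans (cong suc (length-filter-∁ P? xs)) (sym (+-suc _ _))

𝟙 : ∀ {P : Set} → Dec P → ℕ
𝟙 P? = if does P? then 1 else 0

𝟙-yes : ∀ {P : Set} (P? : Dec P) → P → 𝟙 P? ≡ 1
𝟙-yes P? p = cong (if_then 1 else 0) (dec-true P? p)

𝟙-no : ∀ {P : Set} (P? : Dec P) → ¬ P → 𝟙 P? ≡ 0
𝟙-no P? ¬p = cong (if_then 1 else 0) (dec-false P? ¬p)

𝟙≤1 : ∀ {P : Set} (P? : Dec P) → 𝟙 P? ≤ 1
𝟙≤1 (yes _) = ≤-refl
𝟙≤1 (no _)  = z≤n

δ : ℕ → ℕ → ℕ
δ x y = 𝟙 (x ≟ y)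

δ-≡ : ∀ {x y} → x ≡ y → δ x y ≡ 1
δ-≡ {x} {y} = 𝟙-yes (x ≟ y)

δ-refl : ∀ x → δ x x ≡ 1
δ-refl x = δ-≡ {x} refl

δ-≢ : ∀ {x y} → x ≢ y → δ x y ≡ 0
δ-≢ {x} {y} = 𝟙-no (x ≟ y)

𝟙-cong : ∀ {P Q : Set} (P? : Dec P) (Q? : Dec Q) → (P → Q) → (Q → P) → 𝟙 P? ≡ 𝟙 Q?
𝟙-cong (yes _) (yes _) _   _   = refl
𝟙-cong (no _)  (no _)  _   _   = refl
𝟙-cong (yes p) (no ¬q) p→q _   = ⊥-elim (¬q (p→q p))
𝟙-cong (no ¬p) (yes q) _   q→p = ⊥-elim (¬p (q→p q))

∑ : ∀ {A : Set} → List A → (A → ℕ) → ℕ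
∑ []       f = 0
∑ (x ∷ xs) f = f x + ∑ xs f

syntax ∑ xs (λ x → e) = ∑[ x ∈ xs ] e

∑-++ : ∀ {A : Set} xs ys (f : A → ℕ) → ∑ (xs ++ ys) f ≡ ∑ xs f + ∑ ys f
∑-++ []       ys f = refl
∑-++ (x ∷ xs) ys f = trans (cong (f x +_) (∑-++ xs ys f)) (sym (+-assoc (f x) _ _))

∑-+ : ∀ {A : Set} xs (f g : A → ℕ) → ∑[ x ∈ xs ] (f x + g x) ≡ ∑ xs f + ∑ xs g
∑-+ []       f g = refl
∑-+ (x ∷ xs) f g = trans (cong (f x + g x +_) (∑-+ xs f g)) (+-interchange (f x) (g x) _ _)

∑-* : ∀ {A : Set} c xs (f : A → ℕ) → ∑[ x ∈ xs ] (c * f x) ≡ c * ∑ xs f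
∑-* c []       f = sym (*-zeroʳ c)
∑-* c (x ∷ xs) f = trans (cong (c * f x +_) (∑-* c xs f)) (sym (*-distribˡ-+ c (f x) _))

∑-const : ∀ {A : Set} (xs : List A) c → ∑[ x ∈ xs ] c ≡ length xs * c
∑-const []       c = refl
∑-const (x ∷ xs) c = cong (c +_) (∑-const xs c)

∑-downFrom-const : ∀ n c → ∑[ i ∈ downFrom n ] c ≡ n * c
∑-downFrom-const n c = trans (∑-const (downFrom n) c) (cong (_* c) (length-downFrom n))

∑-0 : ∀ {A : Set} (xs : List A) → ∑[ x ∈ xs ] 0 ≡ 0
∑-0 []       = refl
∑-0 (_ ∷ xs) = ∑-0 xs

∑-cong : ∀ {A : Set} xs {f g : A → ℕ} → (∀ {x} → x ∈ xs → f x ≡ g x) → ∑ xs f ≡ ∑ xs g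
∑-cong []       f≡g = refl
∑-cong (x ∷ xs) f≡g = cong₂ _+_ (f≡g (here refl)) (∑-cong xs (f≡g ∘ there))

∑-mono : ∀ {A : Set} xs {f g : A → ℕ} → (∀ {x} → x ∈ xs → f x ≤ g x) → ∑ xs f ≤ ∑ xs g
∑-mono []       f≤g = z≤n
∑-mono (x ∷ xs) f≤g = +-mono-≤ (f≤g (here refl)) (∑-mono xs (f≤g ∘ there))

∈⇒≤∑ : ∀ {A : Set} {xs x} (f : A → ℕ) → x ∈ xs → f x ≤ ∑ xs f
∈⇒≤∑ {xs = x ∷ xs} f (here refl) = m≤m+n (f x) _
∈⇒≤∑ {xs = y ∷ xs} f (there x∈xs) = ≤-trans (∈⇒≤∑ f x∈xs) (m≤n+m _ (f y))

∑-swap : ∀ {A B : Set} xs (ys : List B) (g : A → B → ℕ) →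
         ∑[ x ∈ xs ] ∑[ y ∈ ys ] g x y ≡ ∑[ y ∈ ys ] ∑[ x ∈ xs ] g x y
∑-swap xs []       g = ∑-0 xs
∑-swap xs (y ∷ ys) g = trans (∑-+ xs (λ x → g x y) (λ x → ∑[ y ∈ ys ] g x y))
                             (cong (∑[ x ∈ xs ] g x y +_) (∑-swap xs ys g))

∑-map : ∀ {A B : Set} (g : A → B) xs (f : B → ℕ) → ∑ (map g xs) f ≡ ∑[ x ∈ xs ] f (g x)
∑-map g []       f = refl
∑-map g (x ∷ xs) f = cong (f (g x) +_) (∑-map g xs f)

∑δ≡length-filter : ∀ {A : Set} (f : A → ℕ) j xs → ∑[ x ∈ xs ] δ (f x) j ≡ length (filter (λ x → f x ≟ j) xs)
∑δ≡length-filter f j []       = refl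
∑δ≡length-filter f j (x ∷ xs) with does (f x ≟ j)
... | true  = cong suc (∑δ≡length-filter f j xs)
... | false = ∑δ≡length-filter f j xs

∑-concatMap : ∀ {A B : Set} (g : A → List B) xs (f : B → ℕ) → ∑ (concatMap g xs) f ≡ ∑[ x ∈ xs ] ∑ (g x) f
∑-concatMap g []       f = refl
∑-concatMap g (x ∷ xs) f = trans (∑-++ (g x) (concatMap g xs) f) (cong (∑ (g x) f +_) (∑-concatMap g xs f))

∑-δ-downFrom : ∀ n j → ∑[ i ∈ downFrom n ] δ j i ≡ 𝟙 (j <? n)
∑-δ-downFrom zero    j = refl
∑-δ-downFrom (suc n) j with j ≟ n
... | yes refl = trans (cong₂ _+_ (δ-refl n) (trans (∑-δ-downFrom n n) (𝟙-no (n <? n) (n≮n n))))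
                       (sym (𝟙-yes (n <? suc n) (n<1+n n)))
... | no  j≢n  = trans (cong₂ _+_ (δ-≢ j≢n) (∑-δ-downFrom n j)) (𝟙-cong (j <? n) (j <? suc n) m<n⇒m<1+n
                                                  (λ j<1+n → ≤∧≢⇒< (s≤s⁻¹ j<1+n) j≢n))

∑-downFrom-suc : ∀ n (f : ℕ → ℕ) → ∑ (downFrom (suc n)) f ≡ f 0 + ∑[ i ∈ downFrom n ] f (suc i)
∑-downFrom-suc zero    f = refl
∑-downFrom-suc (suc n) f = trans (cong (f (suc n) +_) (∑-downFrom-suc n f)) (+-left-comm (f (suc n)) (f 0) _)

∑-three-neighbours : ∀ n (f : ℕ → ℕ) →
  ∑[ j ∈ downFrom (suc n) ] (f (pred j) + f j + f (suc j ⊓ n)) ≡ 3 * ∑ (downFrom (suc n)) f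
∑-three-neighbours n f = begin
  ∑[ j ∈ downFrom (suc n) ] (f (pred j) + f j + f (suc j ⊓ n))
    ≡⟨ ∑-+ (downFrom (suc n)) (λ j → f (pred j) + f j) (λ j → f (suc j ⊓ n)) ⟩
  ∑[ j ∈ downFrom (suc n) ] (f (pred j) + f j) + ∑[ j ∈ downFrom (suc n) ] f (suc j ⊓ n)
    ≡⟨ cong (_+ ∑[ j ∈ downFrom (suc n) ] f (suc j ⊓ n)) (∑-+ (downFrom (suc n)) (f ∘ pred) f) ⟩
  ∑[ j ∈ downFrom (suc n) ] f (pred j) + Σf + ∑[ j ∈ downFrom (suc n) ] f (suc j ⊓ n)
    ≡⟨ cong₂ (λ u v → u + Σf + v) (∑-downFrom-suc n (f ∘ pred)) shifted-down ⟩
  (f 0 + S) + Σf + (f n + S′)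
    ≡⟨ rearrange (f 0) S Σf (f n) S′ ⟩
  (f 0 + S′) + Σf + (f n + S)
    ≡⟨ cong (λ u → u + Σf + Σf) (∑-downFrom-suc n f) ⟨
  Σf + Σf + Σf
    ≡⟨ thrice Σf ⟩
  3 * Σf ∎
  where
  open ≡-Reasoning
  Σf  = ∑ (downFrom (suc n)) f
  S  = ∑ (downFrom n) f
  S′ = ∑[ j ∈ downFrom n ] f (suc j)
  shifted-down : ∑[ j ∈ downFrom (suc n) ] f (suc j ⊓ n) ≡ f n + S′
  shifted-down = cong₂ _+_ (cong f (m≥n⇒m⊓n≡n (n≤1+n n)))
                           (∑-cong (downFrom n) (λ j∈ → cong f (m≤n⇒m⊓n≡m (∈-downFrom⁻ j∈))))
  rearrange : ∀ a b c d e → a + b + c + (d + e) ≡ a + e + c + (d + b)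
  rearrange = solve-∀
  thrice : ∀ s → s + s + s ≡ 3 * s
  thrice = solve-∀

-- Wilson's theorem

[1+n]²≡1+n*[2+n] : ∀ n → suc n * suc n ≡ 1 + n * (2 + n)
[1+n]²≡1+n*[2+n] = solve-∀

!≡product-applyDownFrom : ∀ n → n ! ≡ product (applyDownFrom suc n)
!≡product-applyDownFrom zero    = refl
!≡product-applyDownFrom (suc n) = cong (suc n *_) (!≡product-applyDownFrom n)

module Wilson (q : ℕ) (p-prime : Prime (2 + q)) where

  private
    p : ℕ
    p = 2 + q

  %-cong-* : ∀ x x′ y y′ → x % p ≡ x′ % p → y % p ≡ y′ % p → (x * y) % p ≡ (x′ * y′) % p
  %-cong-* x x′ y y′ x≡x′ y≡y′ = begin
    (x * y) % p                ≡⟨ %-distribˡ-* x y p ⟩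
    ((x % p) * (y % p)) % p    ≡⟨ cong₂ (λ u v → (u * v) % p) x≡x′ y≡y′ ⟩
    ((x′ % p) * (y′ % p)) % p  ≡⟨ %-distribˡ-* x′ y′ p ⟨
    (x′ * y′) % p              ∎
    where open ≡-Reasoning

  %≡%⇒∣∸ : ∀ m n → m % p ≡ n % p → p ∣ n ∸ m
  %≡%⇒∣∸ m n m≡n = divides (n / p ∸ m / p) (begin
    n ∸ m                                          ≡⟨ cong₂ _∸_ (m≡m%n+[m/n]*n n p) (m≡m%n+[m/n]*n m p) ⟩
    (n % p + (n / p) * p) ∸ (m % p + (m / p) * p)  ≡⟨ cong (λ r → (n % p + (n / p) * p) ∸ (r + (m / p) * p)) m≡n ⟩
    (n % p + (n / p) * p) ∸ (n % p + (m / p) * p)  ≡⟨ [m+n]∸[m+o]≡n∸o (n % p) _ _ ⟩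
    (n / p) * p ∸ (m / p) * p                      ≡⟨ *-distribʳ-∸ p (n / p) (m / p) ⟨
    (n / p ∸ m / p) * p                            ∎)
    where open ≡-Reasoning

  ∣∧<⇒≡0 : ∀ {k} → p ∣ k → k < p → k ≡ 0
  ∣∧<⇒≡0 {zero}  _   _   = refl
  ∣∧<⇒≡0 {suc k} p∣k k<p = ⊥-elim (<⇒≱ k<p (∣⇒≤ p∣k))

  *-cancelˡ-≤-mod : ∀ a {x y} → (a * x) % p ≡ (a * y) % p → ¬ p ∣ a → y < p → x ≤ y → x ≡ y
  *-cancelˡ-≤-mod a {x} {y} ax≡ay p∤a y<p x≤y
    with euclidsLemma a (y ∸ x) p-prime (subst (p ∣_) (sym (*-distribˡ-∸ a y x)) (%≡%⇒∣∸ (a * x) (a * y) ax≡ay))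
  ... | inj₁ p∣a   = ⊥-elim (p∤a p∣a)
  ... | inj₂ p∣y∸x = ≤-antisym x≤y (m∸n≡0⇒m≤n (∣∧<⇒≡0 p∣y∸x (≤-<-trans (m∸n≤m y x) y<p)))

  *-cancelˡ-mod : ∀ a {x y} → (a * x) % p ≡ (a * y) % p → ¬ p ∣ a → x < p → y < p → x ≡ y
  *-cancelˡ-mod a {x} {y} ax≡ay p∤a x<p y<p with ≤-total x y
  ... | inj₁ x≤y = *-cancelˡ-≤-mod a ax≡ay p∤a y<p x≤y
  ... | inj₂ y≤x = sym (*-cancelˡ-≤-mod a (sym ax≡ay) p∤a x<p y≤x)

  0<∧<⇒∤ : ∀ {a} → 0 < a → a < p → ¬ p ∣ a
  0<∧<⇒∤ 0<a a<p p∣a = <⇒≢ 0<a (sym (∣∧<⇒≡0 p∣a a<p))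

  [p-1]²%p≡1 : (suc q * suc q) % p ≡ 1
  [p-1]²%p≡1 = begin
    (suc q * suc q) % p    ≡⟨ cong (_% p) ([1+n]²≡1+n*[2+n] q) ⟩
    (1 + q * p) % p        ≡⟨ %-remove-+ʳ 1 {d = p} (n∣m*n q) ⟩
    1                      ∎
    where open ≡-Reasoning

  inverse : ∀ a → 0 < a → a < p → ∃ λ b → b < p × (a * b) % p ≡ 1
  inverse a@(suc _) _ a<p with coprime-Bézout (prime⇒coprime p-prime a<p)
  ... | Bézout.-+ x y 1+xp≡ya = y % p , m%n<n y p , (begin
    (a * (y % p)) % p  ≡⟨ %-cong-* a a (y % p) y refl (m%n%n≡m%n y p) ⟩
    (a * y) % p        ≡⟨ cong (_% p) (trans (*-comm a y) (sym 1+xp≡ya)) ⟩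
    (1 + x * p) % p    ≡⟨ %-remove-+ʳ 1 {d = p} (n∣m*n x) ⟩
    1                  ∎)
    where open ≡-Reasoning
  ... | Bézout.+- x y 1+ya≡xp = (y * suc q) % p , m%n<n (y * suc q) p , (begin
    (a * ((y * suc q) % p)) % p  ≡⟨ %-cong-* a a ((y * suc q) % p) (y * suc q) refl (m%n%n≡m%n (y * suc q) p) ⟩
    (a * (y * suc q)) % p        ≡⟨ cong (_% p) (*-assoc a y (suc q)) ⟨
    ((a * y) * suc q) % p        ≡⟨ %-cong-* (a * y) (suc q) (suc q) (suc q) ay≡-1 refl ⟩
    (suc q * suc q) % p          ≡⟨ [p-1]²%p≡1 ⟩
    1                            ∎)
    where
    open ≡-Reasoning
    ay≡-1 : (a * y) % p ≡ suc q % p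
    ay≡-1 = trans (%-pred-≡0 {a * y} (trans (cong (λ z → suc z % p) (*-comm a y))
                                    (trans (cong (_% p) 1+ya≡xp) (m*n%n≡0 x p))))
                  (sym (m<n⇒m%n≡m (n<1+n (suc q))))

  Unit : ℕ → Set
  Unit a = 0 < a × a < p

  -- junk value 0 outside 1 … p-1
  inv : ℕ → ℕ
  inv a with a <? p
  ... | no _ = 0
  inv zero    | yes _   = 0
  inv (suc a) | yes a<p = proj₁ (inverse (suc a) z<s a<p)

  inv-spec : ∀ {a} → Unit a → inv a < p × (a * inv a) % p ≡ 1
  inv-spec {suc a} (_ , a<p) with suc a <? p
  ... | yes a<p′ = proj₂ (inverse (suc a) z<s a<p′)
  ... | no  a≮p  = ⊥-elim (a≮p a<p)

  inv-unique : ∀ {a b} → Unit a → b < p → (a * b) % p ≡ 1 → b ≡ inv a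
  inv-unique {a} ua@(0<a , a<p) b<p ab≡1 =
    *-cancelˡ-mod a (trans ab≡1 (sym (proj₂ (inv-spec ua)))) (0<∧<⇒∤ 0<a a<p) b<p (proj₁ (inv-spec ua))

  inv-unit : ∀ {a} → Unit a → Unit (inv a)
  inv-unit {a} ua with inv a | inv-spec ua
  ... | zero  | _ , a0≡1   = ⊥-elim (0≢1+n (trans (sym (cong (_% p) (*-zeroʳ a))) a0≡1))
  ... | suc _ | ia<p , _ = z<s , ia<p

  inv-involutive : ∀ {a} → Unit a → inv (inv a) ≡ a
  inv-involutive {a} ua@(_ , a<p) = sym (inv-unique (inv-unit ua) a<p
    (trans (cong (_% p) (*-comm (inv a) a)) (proj₂ (inv-spec ua))))

  inv-injective : ∀ {a b} → Unit a → Unit b → inv a ≡ inv b → a ≡ b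
  inv-injective ua ub ia≡ib = trans (sym (inv-involutive ua)) (trans (cong inv ia≡ib) (inv-involutive ub))

  inv≡self⇒≡1⊎≡p-1 : ∀ {a} → Unit a → inv a ≡ a → a ≡ 1 ⊎ a ≡ suc q
  inv≡self⇒≡1⊎≡p-1 {suc c} ua@(_ , a<p) ia≡a
    with euclidsLemma c (2 + c) p-prime
           (subst (p ∣_) (cong pred ([1+n]²≡1+n*[2+n] c)) (%≡%⇒∣∸ 1 (suc c * suc c) (sym a²≡1)))
    where
    a²≡1 : (suc c * suc c) % p ≡ 1
    a²≡1 = subst (λ z → (suc c * z) % p ≡ 1) ia≡a (proj₂ (inv-spec ua))
  ... | inj₁ p∣c   = inj₁ (cong suc (∣∧<⇒≡0 p∣c (<-trans (n<1+n c) a<p)))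
  ... | inj₂ p∣2+c = inj₂ (cong pred (≤-antisym a<p (∣⇒≤ p∣2+c)))

  inv-one : inv 1 ≡ 1
  inv-one = sym (inv-unique (z<s , s≤s z<s) (s≤s z<s) refl)

  record InverseClosed (L : List ℕ) : Set where
    field
      unique         : Unique L
      units          : All Unit L
      closed         : ∀ {x} → x ∈ L → inv x ∈ L
      self-inverse⇒1 : ∀ {x} → x ∈ L → inv x ≡ x → x ≡ 1

  InverseClosed-drop-1 : ∀ {L} → InverseClosed (1 ∷ L) → InverseClosed L
  InverseClosed-drop-1 {L} ic = record
    { unique         = tail-unique
    ; units          = All.tail units
    ; closed         = closed′
    ; self-inverse⇒1 = self-inverse⇒1 ∘ there
    }
    where
    open InverseClosed ic
    tail-unique : Unique L
    tail-unique with _ ∷ u ← unique = u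
    closed′ : ∀ {x} → x ∈ L → inv x ∈ L
    closed′ {x} x∈L with closed (there x∈L)
    ... | there ix∈L = ix∈L
    ... | here ix≡1  = ⊥-elim (Unique[x∷xs]⇒x∉xs unique (subst (_∈ L) x≡1 x∈L))
      where
      x≡1 : x ≡ 1
      x≡1 = trans (sym (inv-involutive (All.lookup (All.tail units) x∈L))) (trans (cong inv ix≡1) inv-one)

  InverseClosed-drop-pair : ∀ {a L L′} → InverseClosed (a ∷ L) → L ↭ inv a ∷ L′ → InverseClosed L′
  InverseClosed-drop-pair {a} {L} {L′} ic L↭ = record
    { unique         = tail-unique
    ; units          = All.tabulate unit
    ; closed         = closed′
    ; self-inverse⇒1 = self-inverse⇒1 ∘ there ∘ ∈L′⇒∈L
    }
    where
    open InverseClosed ic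
    ia∷L′-unique : Unique (inv a ∷ L′)
    ia∷L′-unique with _ ∷ u ← unique = Unique-resp-↭ L↭ u
    tail-unique : Unique L′
    tail-unique with _ ∷ u ← ia∷L′-unique = u
    ∈L′⇒∈L : ∀ {x} → x ∈ L′ → x ∈ L
    ∈L′⇒∈L x∈L′ = ∈-resp-↭ (↭-sym L↭) (there x∈L′)
    unit : ∀ {x} → x ∈ L′ → Unit x
    unit x∈L′ = All.lookup units (there (∈L′⇒∈L x∈L′))
    closed′ : ∀ {x} → x ∈ L′ → inv x ∈ L′
    closed′ {x} x∈L′ with closed (there (∈L′⇒∈L x∈L′))
    ... | here ix≡a = ⊥-elim (Unique[x∷xs]⇒x∉xs ia∷L′-unique (subst (_∈ L′) x≡ia x∈L′))
      where
      x≡ia : x ≡ inv a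
      x≡ia = trans (sym (inv-involutive (unit x∈L′))) (cong inv ix≡a)
    ... | there ix∈L with ∈-resp-↭ L↭ ix∈L
    ...   | there ix∈L′ = ix∈L′
    ...   | here ix≡ia  = ⊥-elim (Unique[x∷xs]⇒x∉xs unique (subst (_∈ L) x≡a (∈L′⇒∈L x∈L′)))
      where
      x≡a : x ≡ a
      x≡a = inv-injective (unit x∈L′) (All.lookup units (here refl)) ix≡ia

  product-inverse-closed : ∀ n L → length L ≤ n → InverseClosed L → product L % p ≡ 1
  product-inverse-closed _       []      _        _  = refl
  product-inverse-closed (suc n) (a ∷ L) |a∷L|≤n ic with inv a ≟ a
  ... | yes ia≡a with refl ← InverseClosed.self-inverse⇒1 ic (here refl) ia≡a =
    trans (cong (_% p) (+-identityʳ (product L)))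
          (product-inverse-closed n L (s≤s⁻¹ |a∷L|≤n) (InverseClosed-drop-1 ic))
  ... | no ia≢a with InverseClosed.closed ic (here refl)
  ...   | here ia≡a = ⊥-elim (ia≢a ia≡a)
  ...   | there ia∈L with ys , zs , refl ← ∈-∃++ ia∈L = begin
    (a * product (ys ++ inv a ∷ zs)) % p  ≡⟨ cong (λ z → (a * z) % p) (product-↭ L↭) ⟩
    (a * (inv a * product L′)) % p        ≡⟨ cong (_% p) (*-assoc a (inv a) (product L′)) ⟨
    ((a * inv a) * product L′) % p        ≡⟨ %-cong-* (a * inv a) 1 (product L′) 1 a·inv-a≡1 IH ⟩
    1                                     ∎
    where
    open ≡-Reasoning
    L′ = ys ++ zs
    L↭ : ys ++ inv a ∷ zs ↭ inv a ∷ L′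
    L↭ = shift (inv a) ys zs
    a·inv-a≡1 : (a * inv a) % p ≡ 1 % p
    a·inv-a≡1 = proj₂ (inv-spec (All.lookup (InverseClosed.units ic) (here refl)))
    |L′|≤n : length L′ ≤ n
    |L′|≤n = ≤-trans (n≤1+n _) (≤-trans (≤-reflexive (sym (↭-length L↭))) (s≤s⁻¹ |a∷L|≤n))
    IH : product L′ % p ≡ 1 % p
    IH = product-inverse-closed n L′ |L′|≤n (InverseClosed-drop-pair ic L↭)

  lower-units : List ℕ
  lower-units = applyDownFrom suc q

  ∈-lower-units⁺ : ∀ {x} → 0 < x → x ≤ q → x ∈ lower-units
  ∈-lower-units⁺ {suc i} _ i<q = ∈-applyDownFrom⁺ suc i<q

  ∈-lower-units⁻ : ∀ {x} → x ∈ lower-units → 0 < x × x ≤ q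
  ∈-lower-units⁻ x∈ with i , i<q , refl ← ∈-applyDownFrom⁻ suc x∈ = z<s , i<q

  lower-units-inverse-closed : InverseClosed lower-units
  lower-units-inverse-closed = record
    { unique         = applyDownFrom⁺₁ suc q (λ j<i _ → <⇒≢ j<i ∘ sym ∘ suc-injective)
    ; units          = All.tabulate unit
    ; closed         = closed
    ; self-inverse⇒1 = self-inverse⇒1
    }
    where
    unit : ∀ {x} → x ∈ lower-units → Unit x
    unit x∈ = proj₁ (∈-lower-units⁻ x∈) , s≤s (m≤n⇒m≤1+n (proj₂ (∈-lower-units⁻ x∈)))
    ≢p-1 : ∀ {x} → x ∈ lower-units → x ≢ suc q
    ≢p-1 x∈ = <⇒≢ (s≤s (proj₂ (∈-lower-units⁻ x∈)))
    inv[p-1]≡p-1 : inv (suc q) ≡ suc q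
    inv[p-1]≡p-1 = sym (inv-unique (z<s , n<1+n (suc q)) (n<1+n (suc q)) [p-1]²%p≡1)
    closed : ∀ {x} → x ∈ lower-units → inv x ∈ lower-units
    closed {x} x∈ = ∈-lower-units⁺ (proj₁ (inv-unit (unit x∈))) (s≤s⁻¹ (≤∧≢⇒< (s≤s⁻¹ (proj₂ (inv-unit (unit x∈)))) ix≢p-1))
      where
      ix≢p-1 : inv x ≢ suc q
      ix≢p-1 ix≡p-1 = ≢p-1 x∈ (trans (sym (inv-involutive (unit x∈))) (trans (cong inv ix≡p-1) inv[p-1]≡p-1))
    self-inverse⇒1 : ∀ {x} → x ∈ lower-units → inv x ≡ x → x ≡ 1
    self-inverse⇒1 x∈ ix≡x with inv≡self⇒≡1⊎≡p-1 (unit x∈) ix≡x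
    ... | inj₁ x≡1   = x≡1
    ... | inj₂ x≡p-1 = ⊥-elim (≢p-1 x∈ x≡p-1)

  wilson : suc q ! % p ≡ suc q
  wilson = begin
    (suc q * q !) % p  ≡⟨ %-cong-* (suc q) (suc q) (q !) 1 refl q!≡1 ⟩
    (suc q * 1) % p    ≡⟨ cong (_% p) (*-identityʳ (suc q)) ⟩
    suc q % p          ≡⟨ m<n⇒m%n≡m (n<1+n (suc q)) ⟩
    suc q              ∎
    where
    open ≡-Reasoning
    q!≡1 : q ! % p ≡ 1
    q!≡1 = trans (cong (_% p) (!≡product-applyDownFrom q))
                 (product-inverse-closed q lower-units (≤-reflexive (length-applyDownFrom suc q)) lower-units-inverse-closed)

  p∣[p-1]!+1 : p ∣ suc q ! + 1
  p∣[p-1]!+1 = m%n≡0⇒n∣m (suc q ! + 1) p (begin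
    (suc q ! + 1) % p              ≡⟨ %-distribˡ-+ (suc q !) 1 p ⟩
    ((suc q ! % p) + 1 % p) % p    ≡⟨ cong (λ r → (r + 1) % p) wilson ⟩
    (suc q + 1) % p                ≡⟨ cong (_% p) (+-comm (suc q) 1) ⟩
    p % p                          ≡⟨ n%n≡0 p ⟩
    0                              ∎)
    where open ≡-Reasoning

-- Counting arrangements

_↓_ : ℕ → ℕ → ℕ
s     ↓ zero  = 1
zero  ↓ suc k = 0
suc s ↓ suc k = suc s * (s ↓ k)

↓-suc : ∀ s k → s ↓ suc k ≡ s * (pred s ↓ k)
↓-suc zero    k = refl
↓-suc (suc s) k = refl

n↓n≡n! : ∀ n → n ↓ n ≡ n !
n↓n≡n! zero    = refl
n↓n≡n! (suc n) = cong (suc n *_) (n↓n≡n! n)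

n↓1+n≡0 : ∀ n → n ↓ suc n ≡ 0
n↓1+n≡0 zero    = refl
n↓1+n≡0 (suc n) = trans (cong (suc n *_) (n↓1+n≡0 n)) (*-zeroʳ (suc n))

module Arrangements {A : Set} (_≟_ : DecidableEquality A) where

  Arrangement : List A → ∀ {k} → Vec A k → Set
  Arrangement S v = VecUnique.Unique v × VecAll.All (_∈ S) v

  _─_ : List A → A → List A
  S ─ h = filter (λ x → ¬? (x ≟ h)) S

  length-─ : ∀ {S h} → Unique S → h ∈ S → length (S ─ h) ≡ pred (length S)
  length-─ {x ∷ S} {h} (x∉S ∷ uS) h∈x∷S with x ≟ h | h∈x∷S
  ... | yes refl | _ = cong length (filter-all (λ y → ¬? (y ≟ x)) (All.map (_∘ sym) x∉S))
  ... | no x≢h | here h≡x   = ⊥-elim (x≢h (sym h≡x))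
  ... | no x≢h | there h∈S = trans (cong suc (length-─ uS h∈S)) (suc-pred-length h∈S)
    where
    suc-pred-length : ∀ {xs} → h ∈ xs → suc (pred (length xs)) ≡ length xs
    suc-pred-length (here _)  = refl
    suc-pred-length (there _) = refl

  tail-arrangement : ∀ {S h k} (v : Vec A (suc k)) → Arrangement S v → head v ≡ h → Arrangement (S ─ h) (tail v)
  tail-arrangement (x ∷ xs) (x∉xs ∷ uxs , _ ∷ xs⊆S) refl =
    uxs , VecAll.map (λ (x≢y , y∈S) → ∈-filter⁺ (λ y → ¬? (y ≟ x)) y∈S (x≢y ∘ sym))
                     (VecAll.zip (x∉xs , xs⊆S))

  tail-injective : ∀ {h k} {v w : Vec A (suc k)} → head v ≡ h → head w ≡ h → tail v ≡ tail w → v ≡ w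
  tail-injective {v = x ∷ xs} {y ∷ ys} refl refl refl = refl

  mutual
    arrangements-bound : ∀ k S → Unique S → (X : List (Vec A k)) → Unique X →
      All (Arrangement S) X → length X ≤ length S ↓ k
    arrangements-bound zero    S _ []            _                    _ = z≤n
    arrangements-bound zero    S _ ([] ∷ [])     _                    _ = ≤-refl
    arrangements-bound zero    S _ ([] ∷ [] ∷ X) ((≢[] ∷ _) ∷ _) _ = ⊥-elim (≢[] refl)
    arrangements-bound (suc k) S uS X uX aX = subst (length X ≤_) (sym (↓-suc (length S) k))
      (headed-arrangements-bound k S uS S (All.tabulate id) X uX aX (All.map head∈S aX))
      where
      head∈S : ∀ {v : Vec A (suc k)} → Arrangement S v → head v ∈ S
      head∈S {x ∷ _} (_ , x∈S ∷ _) = x∈S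

    headed-arrangements-bound : ∀ k S → Unique S → ∀ H → All (_∈ S) H →
      (X : List (Vec A (suc k))) → Unique X → All (Arrangement S) X → All (λ v → head v ∈ H) X →
      length X ≤ length H * (pred (length S) ↓ k)
    headed-arrangements-bound k S uS [] _ []      _ _ _          = z≤n
    headed-arrangements-bound k S uS [] _ (v ∷ X) _ _ (() ∷ _)
    headed-arrangements-bound k S uS (h ∷ H) (h∈S ∷ H⊆S) X uX aX hX = begin
      length X                                 ≡⟨ length-filter-∁ starts-with-h? X ⟩
      length with-h + length without-h         ≤⟨ +-mono-≤ with-h-bound without-h-bound ⟩
      pred (length S) ↓ k + length H * (pred (length S) ↓ k) ∎
      where
      open ≤-Reasoning
      starts-with-h? : Decidable (λ (v : Vec A (suc k)) → head v ≡ h)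
      starts-with-h? v = head v ≟ h
      with-h = filter starts-with-h? X
      without-h = filter (¬? ∘ starts-with-h?) X
      with-h-bound : length with-h ≤ pred (length S) ↓ k
      with-h-bound = begin
        length with-h               ≡⟨ length-map tail with-h ⟨
        length (map tail with-h) ≤⟨ arrangements-bound k (S ─ h) (Unique.filter⁺ _ uS) (map tail with-h)
                                         (Unique-map⁺-on tail tail-injective (all-filter starts-with-h? X) (Unique.filter⁺ _ uX))
                                         (All.map⁺ (All.zipWith (λ (a , e) → tail-arrangement _ a e)
                                                      (All.filter⁺ starts-with-h? aX , all-filter starts-with-h? X))) ⟩
        length (S ─ h) ↓ k          ≡⟨ cong (_↓ k) (length-─ uS h∈S) ⟩
        pred (length S) ↓ k         ∎
      without-h-bound : length without-h ≤ length H * (pred (length S) ↓ k)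
      without-h-bound = headed-arrangements-bound k S uS H H⊆S without-h (Unique.filter⁺ _ uX) (All.filter⁺ _ aX)
        (All.zipWith (λ {v} → head∈H {v}) (All.filter⁺ (¬? ∘ starts-with-h?) hX , all-filter (¬? ∘ starts-with-h?) X))
        where
        head∈H : ∀ {v : Vec A (suc k)} → head v ∈ h ∷ H × head v ≢ h → head v ∈ H
        head∈H (here  e  , ≢h) = ⊥-elim (≢h e)
        head∈H (there ∈H , _)  = ∈H

-- Adjacent transpositions acting on a position

τ : ℕ → ℕ → ℕ
τ i q with q ≟ i | q ≟ suc i
... | yes _ | _     = suc i
... | no _  | yes _ = i
... | no _  | no _  = q

τ-≡ : ∀ i → τ i i ≡ suc i
τ-≡ i with i ≟ i
... | yes _  = refl
... | no i≢i = ⊥-elim (i≢i refl)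

τ-≡suc : ∀ i → τ i (suc i) ≡ i
τ-≡suc i with suc i ≟ i | suc i ≟ suc i
... | yes 1+i≡i | _  = ⊥-elim (1+n≢n 1+i≡i)
... | no _ | yes _   = refl
... | no _ | no ≢    = ⊥-elim (≢ refl)

τ-≢ : ∀ i q → q ≢ i → q ≢ suc i → τ i q ≡ q
τ-≢ i q q≢i q≢1+i with q ≟ i | q ≟ suc i
... | yes q≡i | _ = ⊥-elim (q≢i q≡i)
... | no _ | yes q≡1+i = ⊥-elim (q≢1+i q≡1+i)
... | no _ | no _ = refl

τ-suc : ∀ i q → τ (suc i) (suc q) ≡ suc (τ i q)
τ-suc i q with q ≟ i | q ≟ suc i
... | yes refl | _        = τ-≡ (suc q)
... | no _     | yes refl = τ-≡suc (suc i)
... | no q≢i   | no q≢1+i = τ-≢ (suc i) (suc q) (q≢i ∘ suc-injective) (q≢1+i ∘ suc-injective)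

δ-τ-partition : ∀ i j → δ (τ i j) j + δ j i + δ j (suc i) ≡ 1
δ-τ-partition i j with j ≟ i | j ≟ suc i
... | yes refl | _ rewrite δ-≢ (1+n≢n {j}) | δ-refl j | δ-≢ (1+n≢n {j} ∘ sym) = refl
... | no j≢i | yes refl rewrite δ-≢ (1+n≢n {i} ∘ sym) | δ-≢ (1+n≢n {i}) | δ-refl (suc i) = refl
... | no j≢i | no j≢1+i rewrite δ-refl j | δ-≢ j≢i | δ-≢ j≢1+i = refl

hits : ℕ → ℕ → ℕ → ℕ
hits n q j = ∑[ i ∈ downFrom n ] δ (τ i q) j

hits-diagonal : ∀ n j → hits n j j + 𝟙 (j <? n) + ∑[ i ∈ downFrom n ] δ j (suc i) ≡ n
hits-diagonal n j = begin
  hits n j j + 𝟙 (j <? n) + ∑[ i ∈ downFrom n ] δ j (suc i)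
    ≡⟨ cong (λ z → hits n j j + z + ∑[ i ∈ downFrom n ] δ j (suc i)) (∑-δ-downFrom n j) ⟨
  hits n j j + ∑[ i ∈ downFrom n ] δ j i + ∑[ i ∈ downFrom n ] δ j (suc i)
    ≡⟨ cong (_+ ∑[ i ∈ downFrom n ] δ j (suc i)) (∑-+ (downFrom n) (λ i → δ (τ i j) j) (λ i → δ j i)) ⟨
  ∑[ i ∈ downFrom n ] (δ (τ i j) j + δ j i) + ∑[ i ∈ downFrom n ] δ j (suc i)
    ≡⟨ ∑-+ (downFrom n) (λ i → δ (τ i j) j + δ j i) (λ i → δ j (suc i)) ⟨
  ∑[ i ∈ downFrom n ] (δ (τ i j) j + δ j i + δ j (suc i))
    ≡⟨ ∑-cong (downFrom n) (λ {i} _ → δ-τ-partition i j) ⟩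
  ∑[ i ∈ downFrom n ] 1
    ≡⟨ trans (∑-downFrom-const n 1) (*-identityʳ n) ⟩
  n ∎
  where open ≡-Reasoning

δ-pred+∑δ-suc≤1 : ∀ n j → δ j (pred j) + ∑[ i ∈ downFrom n ] δ j (suc i) ≤ 1
δ-pred+∑δ-suc≤1 n zero    = ≤-reflexive (cong suc (∑-0 (downFrom n)))
δ-pred+∑δ-suc≤1 n (suc j) rewrite δ-≢ (1+n≢n {j}) | ∑-δ-downFrom n j = 𝟙≤1 (j <? n)

δ-next+𝟙<≤1 : ∀ n j → j ≤ n → δ j (suc j ⊓ n) + 𝟙 (j <? n) ≤ 1
δ-next+𝟙<≤1 n j j≤n with j <? n
... | yes j<n rewrite m≤n⇒m⊓n≡m j<n | δ-≢ (<⇒≢ (n<1+n j)) = 𝟙≤1 (j <? n)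
... | no  j≮n rewrite ≤-antisym j≤n (≮⇒≥ j≮n) | m≥n⇒m⊓n≡n (n≤1+n n) | δ-refl n | 𝟙-no (n <? n) (n≮n n) =
  ≤-refl

τ-hit⇒1≤hits : ∀ {n i q j} → i < n → τ i q ≡ j → 1 ≤ hits n q j
τ-hit⇒1≤hits {n} {i} {q} {j} i<n τiq≡j =
  subst (_≤ hits n q j) (trans (cong (λ x → δ x j) τiq≡j) (δ-refl j))
    (∈⇒≤∑ (λ i → δ (τ i q) j) (∈-downFrom⁺ i<n))

row-weights-diagonal : ∀ k j → j ≤ suc k → δ j (pred j) + δ j (suc j ⊓ suc k) + k * 1 ≤ 1 + hits (suc k) j j
row-weights-diagonal k j j≤1+k =
  linear (hits-diagonal (suc k) j) (δ-pred+∑δ-suc≤1 (suc k) j) (δ-next+𝟙<≤1 (suc k) j j≤1+k)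
  where
  linear : ∀ {x y h e₁ e₂} → h + e₁ + e₂ ≡ suc k → x + e₂ ≤ 1 → y + e₁ ≤ 1 → x + y + k * 1 ≤ 1 + h
  linear {x} {y} {h} {e₁} {e₂} sum≡ x+e₂≤1 y+e₁≤1 = +-cancelʳ-≤ (e₁ + e₂) _ _ (begin
    x + y + k * 1 + (e₁ + e₂)  ≡⟨ rearrange x y k e₁ e₂ ⟩
    (x + e₂) + (y + e₁) + k    ≤⟨ +-monoˡ-≤ k (+-mono-≤ x+e₂≤1 y+e₁≤1) ⟩
    2 + k                      ≡⟨ cong suc sum≡ ⟨
    suc (h + e₁ + e₂)          ≡⟨ cong suc (+-assoc h e₁ e₂) ⟩
    1 + h + (e₁ + e₂)          ∎)
    where
    open ≤-Reasoning
    rearrange : ∀ x y k e₁ e₂ → x + y + k * 1 + (e₁ + e₂) ≡ (x + e₂) + (y + e₁) + k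
    rearrange = solve-∀

row-weights-off-diagonal : ∀ k {q j} → j ≤ suc k → q ≢ j → δ q (pred j) + δ q (suc j ⊓ suc k) ≤ hits (suc k) q j
row-weights-off-diagonal k {q} {j} j≤1+k q≢j with q ≟ pred j | q ≟ suc j ⊓ suc k
... | no q≢pj | no q≢nj = subst (_≤ hits (suc k) q j) (sym (cong₂ _+_ (δ-≢ q≢pj) (δ-≢ q≢nj))) z≤n
row-weights-off-diagonal k {q} {zero}  _     q≢j | yes q≡pj | _ = ⊥-elim (q≢j q≡pj)
row-weights-off-diagonal k {q} {suc j} j<1+k _   | yes q≡j  | _ =
  subst (_≤ hits (suc k) q (suc j)) (sym (cong₂ _+_ (δ-≡ q≡j) (δ-≢ q≢nj)))
    (τ-hit⇒1≤hits {q = q} j<1+k (trans (cong (τ j) q≡j) (τ-≡ j)))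
  where
  q≢nj : q ≢ suc (suc j) ⊓ suc k
  q≢nj q≡nj = <⇒≢ (⊓-pres-m< (m<n⇒m<1+n (n<1+n j)) j<1+k) (trans (sym q≡j) q≡nj)
row-weights-off-diagonal k {q} {j} j≤1+k q≢j | no q≢pj | yes q≡nj with j <? suc k
... | yes j<1+k = subst (_≤ hits (suc k) q j) (sym (cong₂ _+_ (δ-≢ q≢pj) (δ-≡ q≡nj)))
                    (τ-hit⇒1≤hits {q = q} j<1+k (trans (cong (τ j) (trans q≡nj (m≤n⇒m⊓n≡m j<1+k))) (τ-≡suc j)))
... | no  j≮1+k = ⊥-elim (q≢j (trans q≡nj (trans (m≥n⇒m⊓n≡n (≤-trans (≮⇒≥ j≮1+k) (n≤1+n j)))
                                                 (≤-antisym (≮⇒≥ j≮1+k) j≤1+k))))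

row-weights≤ball-hits : ∀ k q j → j ≤ suc k →
  δ q (pred j) + δ q (suc j ⊓ suc k) + k * δ q j ≤ δ q j + hits (suc k) q j
row-weights≤ball-hits k q j j≤1+k with q ≟ j
... | yes refl rewrite δ-refl q = row-weights-diagonal k q j≤1+k
... | no q≢j rewrite δ-≢ q≢j | *-zeroʳ k | +-identityʳ (δ q (pred j) + δ q (suc j ⊓ suc k)) =
  row-weights-off-diagonal k j≤1+k q≢j

-- Permutations, the position of 0, and balls of radius one

pos₀ : ∀ {n m} → Vec (Fin n) m → ℕ
pos₀ []             = 0
pos₀ (Fin.zero ∷ _)  = 0
pos₀ (Fin.suc _ ∷ v) = suc (pos₀ v)

module _ {A : Set} where

  swapAt : ∀ {m} → ℕ → Vec A m → Vec A m
  swapAt zero    (x ∷ y ∷ v) = y ∷ x ∷ v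
  swapAt (suc i) (x ∷ v)     = x ∷ swapAt i v
  swapAt _       v           = v

  AdjSwap-swapAt : ∀ {m} i (v : Vec A m) → suc i < m → AdjSwap v (swapAt i v)
  AdjSwap-swapAt zero    (x ∷ y ∷ v) _          = here x y v
  AdjSwap-swapAt zero    (x ∷ [])    (s≤s ())
  AdjSwap-swapAt (suc i) (x ∷ v)     (s≤s i<m) = there x (AdjSwap-swapAt i v i<m)

  AdjSwap-sym : ∀ {m} {u v : Vec A m} → AdjSwap u v → AdjSwap v u
  AdjSwap-sym (here x y v) = here y x v
  AdjSwap-sym (there x s)  = there x (AdjSwap-sym s)

  AdjSwap-All : ∀ {P : A → Set} {m} {u v : Vec A m} → AdjSwap u v → VecAll.All P u → VecAll.All P v
  AdjSwap-All (here x y v) (px ∷ py ∷ pv) = py ∷ px ∷ pv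
  AdjSwap-All (there x s)  (px ∷ pv)      = px ∷ AdjSwap-All s pv

  AdjSwap-Unique : ∀ {m} {u v : Vec A m} → AdjSwap u v → VecUnique.Unique u → VecUnique.Unique v
  AdjSwap-Unique (here x y v) ((x≢y ∷ x∉v) ∷ y∉v ∷ uv) = ((x≢y ∘ sym) ∷ y∉v) ∷ x∉v ∷ uv
  AdjSwap-Unique (there x s)  (x∉v ∷ uv)               = AdjSwap-All s x∉v ∷ AdjSwap-Unique s uv

  swapAt-≢ : ∀ {m} i (v : Vec A m) → suc i < m → VecUnique.Unique v → swapAt i v ≢ v
  swapAt-≢ zero    (x ∷ y ∷ v) _         ((x≢y ∷ _) ∷ _) refl = x≢y refl
  swapAt-≢ zero    (x ∷ [])    (s≤s ())  _
  swapAt-≢ (suc i) (x ∷ v)     (s≤s i<m) (_ ∷ uv)        eq   = swapAt-≢ i v i<m uv (∷-injectiveʳ eq)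

  swapAt-injective : ∀ {m} i j (v : Vec A m) → i < j → suc j < m → VecUnique.Unique v → swapAt i v ≢ swapAt j v
  swapAt-injective zero    (suc j) (x ∷ y ∷ v) _         _           ((x≢y ∷ _) ∷ _) eq = x≢y (sym (∷-injectiveˡ eq))
  swapAt-injective zero    (suc j) (x ∷ [])    _         (s≤s ())
  swapAt-injective (suc i) (suc j) (x ∷ v)     (s≤s i<j) (s≤s 1+j<m) (_ ∷ uv)        eq =
    swapAt-injective i j v i<j 1+j<m uv (∷-injectiveʳ eq)

  deleteAt : ∀ {m} → ℕ → Vec A (suc m) → Vec A m
  deleteAt zero    (x ∷ v)     = v
  deleteAt (suc j) (x ∷ [])    = []
  deleteAt (suc j) (x ∷ y ∷ v) = x ∷ deleteAt j (y ∷ v)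

  deleteAt-All : ∀ {P : A → Set} {m} j (v : Vec A (suc m)) → VecAll.All P v → VecAll.All P (deleteAt j v)
  deleteAt-All zero    (x ∷ v)     (_ ∷ pv)  = pv
  deleteAt-All (suc j) (x ∷ [])    _         = []
  deleteAt-All (suc j) (x ∷ y ∷ v) (px ∷ pv) = px ∷ deleteAt-All j (y ∷ v) pv

  deleteAt-Unique : ∀ {m} j (v : Vec A (suc m)) → VecUnique.Unique v → VecUnique.Unique (deleteAt j v)
  deleteAt-Unique zero    (x ∷ v)     (_ ∷ uv)    = uv
  deleteAt-Unique (suc j) (x ∷ [])    _           = []
  deleteAt-Unique (suc j) (x ∷ y ∷ v) (x∉v ∷ uv) = deleteAt-All j (y ∷ v) x∉v ∷ deleteAt-Unique j (y ∷ v) uv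

pos₀-swapAt : ∀ {n m} i (v : Vec (Fin n) m) → suc i < m → VecUnique.Unique v → pos₀ (swapAt i v) ≡ τ i (pos₀ v)
pos₀-swapAt zero    (Fin.zero  ∷ Fin.zero  ∷ v) _         ((0≢0 ∷ _) ∷ _) = ⊥-elim (0≢0 refl)
pos₀-swapAt zero    (Fin.zero  ∷ Fin.suc _ ∷ v) _         _               = sym (τ-≡ 0)
pos₀-swapAt zero    (Fin.suc _ ∷ Fin.zero  ∷ v) _         _               = sym (τ-≡suc 0)
pos₀-swapAt zero    (Fin.suc _ ∷ Fin.suc _ ∷ v) _         _               = sym (τ-≢ 0 (2 + pos₀ v) (λ ()) (λ ()))
pos₀-swapAt zero    (_ ∷ [])                    (s≤s ())  _
pos₀-swapAt (suc i) (Fin.zero  ∷ v)             _         _               = sym (τ-≢ (suc i) 0 (λ ()) (λ ()))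
pos₀-swapAt (suc i) (Fin.suc _ ∷ v)             (s≤s i<m) (_ ∷ uv)        =
  trans (cong suc (pos₀-swapAt i v i<m uv)) (sym (τ-suc i (pos₀ v)))

pos₀<length⊎nonzero : ∀ {n m} (v : Vec (Fin (suc n)) m) → pos₀ v < m ⊎ VecAll.All (_≢ Fin.zero) v
pos₀<length⊎nonzero []              = inj₂ []
pos₀<length⊎nonzero (Fin.zero  ∷ v) = inj₁ z<s
pos₀<length⊎nonzero (Fin.suc x ∷ v) with pos₀<length⊎nonzero v
... | inj₁ lt      = inj₁ (s≤s lt)
... | inj₂ nonzero = inj₂ ((λ ()) ∷ nonzero)

deleteAt-pos₀-nonzero : ∀ {n m} j (v : Vec (Fin (suc n)) (suc m)) → VecUnique.Unique v → pos₀ v ≡ j →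
  VecAll.All (_≢ Fin.zero) (deleteAt j v)
deleteAt-pos₀-nonzero zero    (Fin.zero  ∷ v)     (0∉v ∷ _) _ = VecAll.map (_∘ sym) 0∉v
deleteAt-pos₀-nonzero (suc j) (Fin.suc x ∷ [])    _         _ = []
deleteAt-pos₀-nonzero (suc j) (Fin.suc x ∷ y ∷ v) (_ ∷ uv)  e =
  (λ ()) ∷ deleteAt-pos₀-nonzero j (y ∷ v) uv (suc-injective e)

deleteAt-pos₀-injective : ∀ {n m} j (v w : Vec (Fin n) (suc m)) → pos₀ v ≡ j → pos₀ w ≡ j → j < suc m →
  deleteAt j v ≡ deleteAt j w → v ≡ w
deleteAt-pos₀-injective zero    (Fin.zero  ∷ v)     (Fin.zero   ∷ w)      _ _ _        refl = refl
deleteAt-pos₀-injective (suc j) (Fin.suc x ∷ y ∷ v) (Fin.suc x′ ∷ y′ ∷ w) e e′ (s≤s lt) d =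
  cong₂ _∷_ (∷-injectiveˡ d)
    (deleteAt-pos₀-injective j (y ∷ v) (y′ ∷ w) (suc-injective e) (suc-injective e′) lt (∷-injectiveʳ d))
deleteAt-pos₀-injective (suc j) (_ ∷ []) _ _ _ (s≤s ()) _

Steps-trans : ∀ {A : Set} {m a b} {u v w : Vec A m} → Steps a u v → Steps b v w → Steps (a + b) u w
Steps-trans done         t = t
Steps-trans (step s ss) t = step s (Steps-trans ss t)

module Balls (n : ℕ) where

  private
    V : Set
    V = Vec (Fin (suc n)) (suc n)

  ball : V → List V
  ball σ = σ ∷ map (λ i → swapAt i σ) (downFrom n)

  ∈-ball⇒Steps : ∀ {σ v} → v ∈ ball σ → ∃ λ k → k ≤ 1 × Steps k σ v × Steps k v σ
  ∈-ball⇒Steps (here refl) = 0 , z≤n , done , done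
  ∈-ball⇒Steps {σ} (there v∈) with i , i∈ , refl ← ∈-map⁻ (λ i → swapAt i σ) v∈ =
    1 , ≤-refl , step swap done , step (AdjSwap-sym swap) done
    where
    swap = AdjSwap-swapAt i σ (s≤s (∈-downFrom⁻ i∈))

  balls-disjoint : ∀ {σ σ′} → KendallAtLeast 3 σ σ′ → Disjoint (ball σ) (ball σ′)
  balls-disjoint far (v∈ , v∈′)
    with k , k≤1 , σ→v , _ ← ∈-ball⇒Steps v∈ | k′ , k′≤1 , _ , v→σ′ ← ∈-ball⇒Steps v∈′ =
    far (k + k′) (s≤s (+-mono-≤ k≤1 k′≤1)) (Steps-trans σ→v v→σ′)

  ball-Unique : ∀ {σ} → IsPerm (suc n) σ → Unique (ball σ)
  ball-Unique {σ} uσ = All.tabulate σ≢ ∷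
    Unique-map⁺-on (λ i → swapAt i σ) swap-injective (All.tabulate ∈-downFrom⁻) (Unique.downFrom⁺ n)
    where
    σ≢ : ∀ {v} → v ∈ map (λ i → swapAt i σ) (downFrom n) → σ ≢ v
    σ≢ v∈ with i , i∈ , refl ← ∈-map⁻ (λ i → swapAt i σ) v∈ =
      swapAt-≢ i σ (s≤s (∈-downFrom⁻ i∈)) uσ ∘ sym
    swap-injective : ∀ {i j} → i < n → j < n → swapAt i σ ≡ swapAt j σ → i ≡ j
    swap-injective {i} {j} i<n j<n eq with <-cmp i j
    ... | tri< i<j _ _ = ⊥-elim (swapAt-injective i j σ i<j (s≤s j<n) uσ eq)
    ... | tri≈ _ i≡j _ = i≡j
    ... | tri> _ _ j<i = ⊥-elim (swapAt-injective j i σ j<i (s≤s i<n) uσ (sym eq))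

  ball-perms : ∀ {σ} → IsPerm (suc n) σ → All (IsPerm (suc n)) (ball σ)
  ball-perms {σ} uσ = uσ ∷ All.map⁺ (All.tabulate (λ {i} i∈ →
    AdjSwap-Unique (AdjSwap-swapAt i σ (s≤s (∈-downFrom⁻ i∈))) uσ))

  ∑δ-pos₀-ball : ∀ j {σ} → IsPerm (suc n) σ →
    ∑[ v ∈ ball σ ] δ (pos₀ v) j ≡ δ (pos₀ σ) j + hits n (pos₀ σ) j
  ∑δ-pos₀-ball j {σ} uσ = cong (δ (pos₀ σ) j +_) (begin
    ∑[ v ∈ map (λ i → swapAt i σ) (downFrom n) ] δ (pos₀ v) j  ≡⟨ ∑-map (λ i → swapAt i σ) (downFrom n) (λ v → δ (pos₀ v) j) ⟩
    ∑[ i ∈ downFrom n ] δ (pos₀ (swapAt i σ)) j               ≡⟨ ∑-cong (downFrom n) (cong (λ x → δ x j) ∘ pos₀-swap) ⟩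
    hits n (pos₀ σ) j                                          ∎)
    where
    open ≡-Reasoning
    pos₀-swap : ∀ {i} → i ∈ downFrom n → pos₀ (swapAt i σ) ≡ τ i (pos₀ σ)
    pos₀-swap {i} i∈ = pos₀-swapAt i σ (s≤s (∈-downFrom⁻ i∈)) uσ

  open Arrangements (Fin._≟_ {suc n})

  nonzero : List (Fin (suc n))
  nonzero = tabulate Fin.suc

  nonzero-Unique : Unique nonzero
  nonzero-Unique = Unique.tabulate⁺ Fin.suc-injective

  ≢0⇒∈nonzero : ∀ {x} → x ≢ Fin.zero → x ∈ nonzero
  ≢0⇒∈nonzero {Fin.zero}  0≢0 = ⊥-elim (0≢0 refl)
  ≢0⇒∈nonzero {Fin.suc y} _   = ∈-tabulate⁺ y

  pos₀<length : ∀ {σ} → IsPerm (suc n) σ → pos₀ σ < suc n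
  pos₀<length {σ} uσ with pos₀<length⊎nonzero σ
  ... | inj₁ lt = lt
  ... | inj₂ all-nonzero = ⊥-elim (1+n≰n (begin
    1                              ≤⟨ arrangements-bound (suc n) nonzero nonzero-Unique (σ ∷ []) ([] ∷ [])
                                        ((uσ , VecAll.map ≢0⇒∈nonzero all-nonzero) ∷ []) ⟩
    length nonzero ↓ suc n         ≡⟨ cong (_↓ suc n) (length-tabulate {n = n} Fin.suc) ⟩
    n ↓ suc n                      ≡⟨ n↓1+n≡0 n ⟩
    0                              ∎))
    where open ≤-Reasoning

  -- Deleting the 0 at position j is injective and leaves an arrangement of the nonzero symbols.
  fibre-bound : ∀ j → j < suc n → (X : List V) → Unique X → All (IsPerm (suc n)) X → ∑[ v ∈ X ] δ (pos₀ v) j ≤ n !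
  fibre-bound j j<1+n X uX pX = begin
    ∑[ v ∈ X ] δ (pos₀ v) j        ≡⟨ ∑δ≡length-filter pos₀ j X ⟩
    length fibre                   ≡⟨ length-map (deleteAt j) fibre ⟨
    length (map (deleteAt j) fibre) ≤⟨ arrangements-bound n nonzero nonzero-Unique (map (deleteAt j) fibre)
                                         (Unique-map⁺-on (deleteAt j) (λ e e′ → deleteAt-pos₀-injective j _ _ e e′ j<1+n)
                                            (all-filter at-j? X) (Unique.filter⁺ at-j? uX))
                                         (All.map⁺ (All.map deleted-arrangement
                                           (All.zip (All.filter⁺ at-j? pX , all-filter at-j? X)))) ⟩
    length nonzero ↓ n             ≡⟨ cong (_↓ n) (length-tabulate {n = n} Fin.suc) ⟩
    n ↓ n                          ≡⟨ n↓n≡n! n ⟩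
    n !                            ∎
    where
    open ≤-Reasoning
    at-j? : Decidable (λ (v : V) → pos₀ v ≡ j)
    at-j? v = pos₀ v ≟ j
    fibre = filter at-j? X
    deleted-arrangement : ∀ {v : V} → IsPerm (suc n) v × pos₀ v ≡ j → Arrangement nonzero (deleteAt j v)
    deleted-arrangement {v} (uv , at-j) =
      deleteAt-Unique j v uv , VecAll.map ≢0⇒∈nonzero (deleteAt-pos₀-nonzero j v uv at-j)

  balls : List V → List V
  balls = concatMap ball

  balls-Unique : ∀ {C} → IsCode (suc n) 3 C → Unique (balls C)
  balls-Unique (perms , far) =
    Unique.concat⁺ (All.map⁺ (All.map ball-Unique perms)) (AllPairs.map⁺ (AllPairs.map balls-disjoint far))

  balls-perms : ∀ {C} → All (IsPerm (suc n)) C → All (IsPerm (suc n)) (balls C)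
  balls-perms perms = All.concat⁺ (All.map⁺ (All.map ball-perms perms))

  zeros-at : List V → ℕ → ℕ
  zeros-at C x = ∑[ σ ∈ C ] δ (pos₀ σ) x

  length≡∑zeros-at : ∀ {C} → All (IsPerm (suc n)) C → length C ≡ ∑[ x ∈ downFrom (suc n) ] zeros-at C x
  length≡∑zeros-at {C} perms = begin
    length C                                           ≡⟨ trans (∑-const C 1) (*-identityʳ _) ⟨
    ∑[ σ ∈ C ] 1                                       ≡⟨ ∑-cong C (sym ∘ one-position) ⟩
    ∑[ σ ∈ C ] ∑[ x ∈ downFrom (suc n) ] δ (pos₀ σ) x  ≡⟨ ∑-swap C (downFrom (suc n)) (λ σ x → δ (pos₀ σ) x) ⟩
    ∑[ x ∈ downFrom (suc n) ] zeros-at C x             ∎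
    where
    open ≡-Reasoning
    one-position : ∀ {σ} → σ ∈ C → ∑[ x ∈ downFrom (suc n) ] δ (pos₀ σ) x ≡ 1
    one-position {σ} σ∈ = trans (∑-δ-downFrom (suc n) (pos₀ σ))
                                (𝟙-yes (pos₀ σ <? suc n) (pos₀<length (All.lookup perms σ∈)))

row-bound : ∀ k {C} → IsCode (2 + k) 3 C → ∀ j → j ≤ suc k → let open Balls (suc k) in
  zeros-at C (pred j) + zeros-at C (suc j ⊓ suc k) + k * zeros-at C j ≤ suc k !
row-bound k {C} code@(perms , _) j j≤1+k = begin
  a (pred j) + a (suc j ⊓ suc k) + k * a j
    ≡⟨ cong₂ _+_ (∑-+ C (λ σ → δ (pos₀ σ) (pred j)) (λ σ → δ (pos₀ σ) (suc j ⊓ suc k)))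
                 (∑-* k C (λ σ → δ (pos₀ σ) j)) ⟨
  ∑[ σ ∈ C ] (δ (pos₀ σ) (pred j) + δ (pos₀ σ) (suc j ⊓ suc k)) + ∑[ σ ∈ C ] (k * δ (pos₀ σ) j)
    ≡⟨ ∑-+ C (λ σ → δ (pos₀ σ) (pred j) + δ (pos₀ σ) (suc j ⊓ suc k)) (λ σ → k * δ (pos₀ σ) j) ⟨
  ∑[ σ ∈ C ] (δ (pos₀ σ) (pred j) + δ (pos₀ σ) (suc j ⊓ suc k) + k * δ (pos₀ σ) j)
    ≤⟨ ∑-mono C (λ {σ} _ → row-weights≤ball-hits k (pos₀ σ) j j≤1+k) ⟩
  ∑[ σ ∈ C ] (δ (pos₀ σ) j + hits (suc k) (pos₀ σ) j)
    ≡⟨ ∑-cong C (λ σ∈ → ∑δ-pos₀-ball j (All.lookup perms σ∈)) ⟨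
  ∑[ σ ∈ C ] ∑[ v ∈ ball σ ] δ (pos₀ v) j
    ≡⟨ ∑-concatMap ball C (λ v → δ (pos₀ v) j) ⟨
  ∑[ v ∈ balls C ] δ (pos₀ v) j
    ≤⟨ fibre-bound j (s≤s j≤1+k) (balls C) (balls-Unique code) (balls-perms perms) ⟩
  suc k !
    ∎
  where
  open ≤-Reasoning
  open Balls (suc k)
  a = zeros-at C

-- Averaging over the positions of 0

[m∸n]+n≡m+[n∸m] : ∀ m n → (m ∸ n) + n ≡ m + (n ∸ m)
[m∸n]+n≡m+[n∸m] m n with ≤-total n m
... | inj₁ n≤m rewrite m≤n⇒m∸n≡0 n≤m = trans (m∸n+n≡m n≤m) (sym (+-identityʳ m))
... | inj₂ m≤n rewrite m≤n⇒m∸n≡0 m≤n = sym (m+[n∸m]≡n m≤n)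

-- The row has total weight 2 + k = p, so a weighted sum ≤ N = p·m - 1 leaves a deficit of at least 1.
row-deficit : ∀ k m N x y z → N + 1 ≡ (2 + k) * m → x + y + k * z ≤ N →
  1 + ((x ∸ m) + (y ∸ m) + k * (z ∸ m)) ≤ (m ∸ x) + (m ∸ y) + k * (m ∸ z)
row-deficit k m N x y z N+1≡ row≤N = +-cancelʳ-≤ N (1 + above) below (begin
  1 + above + N            ≡⟨ +-comm (1 + above) N ⟩
  N + (1 + above)          ≡⟨ +-assoc N 1 above ⟨
  N + 1 + above            ≡⟨ cong (_+ above) N+1≡ ⟩
  (2 + k) * m + above      ≡⟨ balance ⟨
  below + (x + y + k * z)  ≤⟨ +-monoʳ-≤ below row≤N ⟩
  below + N                ∎)
  where
  open ≤-Reasoning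
  above = (x ∸ m) + (y ∸ m) + k * (z ∸ m)
  below = (m ∸ x) + (m ∸ y) + k * (m ∸ z)
  split = [m∸n]+n≡m+[n∸m] m
  balance : below + (x + y + k * z) ≡ (2 + k) * m + above
  balance = begin-equality
    below + (x + y + k * z)                            ≡⟨ regroup k (m ∸ x) x (m ∸ y) y (m ∸ z) z ⟨
    ((m ∸ x) + x) + ((m ∸ y) + y) + k * ((m ∸ z) + z)  ≡⟨ cong₂ (λ u w → u + k * w) (cong₂ _+_ (split x) (split y)) (split z) ⟩
    (m + (x ∸ m)) + (m + (y ∸ m)) + k * (m + (z ∸ m))  ≡⟨ regroup′ k m (x ∸ m) (y ∸ m) (z ∸ m) ⟨
    (2 + k) * m + above                                ∎
    where
    regroup : ∀ k a x b y c z → (a + x) + (b + y) + k * (c + z) ≡ (a + b + k * c) + (x + y + k * z)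
    regroup = solve-∀
    regroup′ : ∀ k m a b c → (2 + k) * m + (a + b + k * c) ≡ (m + a) + (m + b) + k * (m + c)
    regroup′ = solve-∀

-- If z ≥ m, the k ≥ 3 copies of z ∸ m in the row pay for 3·(z ∸ m); otherwise m ∸ z ≥ 1.
centre-deficit : ∀ k m x y z → 3 ≤ k →
  1 + ((x ∸ m) + (y ∸ m) + k * (z ∸ m)) ≤ (m ∸ x) + (m ∸ y) + k * (m ∸ z) →
  1 + 3 * (z ∸ m) ≤ (m ∸ x) + (m ∸ z) + (m ∸ y)
centre-deficit k m x y z 3≤k deficit with m ∸ z in eq
... | zero = begin
  1 + 3 * (z ∸ m)                                ≤⟨ +-monoʳ-≤ 1 (*-monoˡ-≤ (z ∸ m) 3≤k) ⟩
  1 + k * (z ∸ m)                                ≤⟨ +-monoʳ-≤ 1 (m≤n+m (k * (z ∸ m)) ((x ∸ m) + (y ∸ m))) ⟩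
  1 + ((x ∸ m) + (y ∸ m) + k * (z ∸ m))          ≤⟨ deficit ⟩
  (m ∸ x) + (m ∸ y) + k * 0                      ≡⟨ rearrange (m ∸ x) (m ∸ y) k ⟩
  (m ∸ x) + 0 + (m ∸ y)                          ∎
  where
  open ≤-Reasoning
  rearrange : ∀ a b k → a + b + k * 0 ≡ a + 0 + b
  rearrange = solve-∀
... | suc d = begin
  1 + 3 * (z ∸ m)                                ≡⟨ cong (λ t → 1 + 3 * t) z∸m≡0 ⟩
  1                                              ≤⟨ s≤s z≤n ⟩
  suc d                                          ≤⟨ m≤n+m (suc d) (m ∸ x) ⟩
  (m ∸ x) + suc d                                ≤⟨ m≤m+n _ (m ∸ y) ⟩
  (m ∸ x) + suc d + (m ∸ y)                      ∎
  where
  open ≤-Reasoning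
  z∸m≡0 : z ∸ m ≡ 0
  z∸m≡0 = m≤n⇒m∸n≡0 (<⇒≤ (m∸n≢0⇒n<m {m} {z} (λ m∸z≡0 → 0≢1+n (trans (sym m∸z≡0) eq))))

averaging-bound : ∀ k (a : ℕ → ℕ) N → 3 ≤ k → 2 + k ∣ N + 1 →
  (∀ j → j ≤ suc k → a (pred j) + a (suc j ⊓ suc k) + k * a j ≤ N) →
  3 * ∑ (downFrom (2 + k)) a + (2 + k) ≤ 3 * (N + 1)
averaging-bound k a N 3≤k (divides m N+1≡m*p) rows = +-cancelʳ-≤ (3 * Σabove) _ _ (begin
  3 * Σa + p + 3 * Σabove            ≡⟨ +-assoc (3 * Σa) p (3 * Σabove) ⟩
  3 * Σa + (p + 3 * Σabove)          ≤⟨ +-monoʳ-≤ (3 * Σa) deficits ⟩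
  3 * Σa + 3 * Σbelow                ≡⟨ *-distribˡ-+ 3 Σa Σbelow ⟨
  3 * (Σa + Σbelow)                  ≡⟨ cong (3 *_) (+-comm Σa Σbelow) ⟩
  3 * (Σbelow + Σa)                  ≡⟨ cong (3 *_) balance ⟩
  3 * (p * m + Σabove)               ≡⟨ *-distribˡ-+ 3 (p * m) Σabove ⟩
  3 * (p * m) + 3 * Σabove           ≡⟨ cong (λ t → 3 * t + 3 * Σabove) N+1≡ ⟨
  3 * (N + 1) + 3 * Σabove           ∎)
  where
  open ≤-Reasoning
  p = 2 + k
  N+1≡ : N + 1 ≡ p * m
  N+1≡ = trans N+1≡m*p (*-comm m p)
  below above : ℕ → ℕ
  below x = m ∸ a x
  above x = a x ∸ m
  positions = downFrom p
  Σa = ∑ positions a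
  Σbelow = ∑ positions below
  Σabove = ∑ positions above
  balance : Σbelow + Σa ≡ p * m + Σabove
  balance = begin-equality
    Σbelow + Σa                         ≡⟨ ∑-+ positions below a ⟨
    ∑[ x ∈ positions ] (below x + a x)  ≡⟨ ∑-cong positions (λ {x} _ → [m∸n]+n≡m+[n∸m] m (a x)) ⟩
    ∑[ x ∈ positions ] (m + above x)    ≡⟨ ∑-+ positions (λ _ → m) above ⟩
    ∑[ x ∈ positions ] m + Σabove       ≡⟨ cong (_+ Σabove) (∑-downFrom-const p m) ⟩
    p * m + Σabove                      ∎
  deficits : p + 3 * Σabove ≤ 3 * Σbelow
  deficits = begin
    p + 3 * Σabove
      ≡⟨ cong₂ _+_ (trans (∑-downFrom-const p 1) (*-identityʳ p)) (∑-* 3 positions above) ⟨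
    ∑[ j ∈ positions ] 1 + ∑[ j ∈ positions ] (3 * above j)
      ≡⟨ ∑-+ positions (λ _ → 1) (λ j → 3 * above j) ⟨
    ∑[ j ∈ positions ] (1 + 3 * above j)
      ≤⟨ ∑-mono positions (λ {j} j∈ → deficit j (s≤s⁻¹ (∈-downFrom⁻ j∈))) ⟩
    ∑[ j ∈ positions ] (below (pred j) + below j + below (suc j ⊓ suc k))
      ≡⟨ ∑-three-neighbours (suc k) below ⟩
    3 * Σbelow
      ∎
    where
    deficit : ∀ j → j ≤ suc k → 1 + 3 * above j ≤ below (pred j) + below j + below (suc j ⊓ suc k)
    deficit j j≤ = centre-deficit k m (a (pred j)) (a (suc j ⊓ suc k)) (a j) 3≤k
                     (row-deficit k m N (a (pred j)) (a (suc j ⊓ suc k)) (a j) N+1≡ (rows j j≤))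

3L+p≤3[N+1]⇒L≤N∸⌈p/3⌉+2 : ∀ L N p → 3 * L + p ≤ 3 * (N + 1) → L ≤ N ∸ ((p + 2) / 3) + 2
3L+p≤3[N+1]⇒L≤N∸⌈p/3⌉+2 L N p 3L+p≤ = begin
  L          ≤⟨ m+n≤o⇒m≤o∸n L L+c≤N+1 ⟩
  N + 1 ∸ c  ≤⟨ N+1∸c≤N∸c+1 ⟩
  N ∸ c + 1  ≤⟨ +-monoʳ-≤ (N ∸ c) (n≤1+n 1) ⟩
  N ∸ c + 2  ∎
  where
  open ≤-Reasoning
  c = (p + 2) / 3
  3c≤p+2 : 3 * c ≤ p + 2
  3c≤p+2 = subst (_≤ p + 2) (*-comm c 3) (m/n*n≤m (p + 2) 3)
  L+c≤N+1 : L + c ≤ N + 1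
  L+c≤N+1 = s≤s⁻¹ (*-cancelˡ-< 3 (L + c) (suc (N + 1)) (begin-strict
    3 * (L + c)        ≡⟨ *-distribˡ-+ 3 L c ⟩
    3 * L + 3 * c      ≤⟨ +-monoʳ-≤ (3 * L) 3c≤p+2 ⟩
    3 * L + (p + 2)    ≡⟨ +-assoc (3 * L) p 2 ⟨
    3 * L + p + 2      ≤⟨ +-monoˡ-≤ 2 3L+p≤ ⟩
    3 * (N + 1) + 2    <⟨ +-monoʳ-< (3 * (N + 1)) (n<1+n 2) ⟩
    3 * (N + 1) + 3    ≡⟨ add-three N ⟩
    3 * suc (N + 1)    ∎))
    where
    open ≤-Reasoning
    add-three : ∀ N → 3 * (N + 1) + 3 ≡ 3 * suc (N + 1)
    add-three = solve-∀
  N+1∸c≤N∸c+1 : N + 1 ∸ c ≤ N ∸ c + 1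
  N+1∸c≤N∸c+1 with c ≤? N
  ... | yes c≤N = ≤-reflexive (+-∸-comm 1 c≤N)
  ... | no  c≰N = ≤-trans (≤-reflexive (m≤n⇒m∸n≡0 (subst (_≤ c) (+-comm 1 N) (≰⇒> c≰N)))) z≤n

m∸n+2≤m∸2 : ∀ m n → 4 ≤ m → 4 ≤ n → m ∸ n + 2 ≤ m ∸ 2
m∸n+2≤m∸2 m n 4≤m 4≤n = begin
  m ∸ n + 2       ≤⟨ +-monoˡ-≤ 2 (∸-monoʳ-≤ m 4≤n) ⟩
  m ∸ 4 + 2       ≡⟨ +-∸-comm 2 4≤m ⟨
  m + 2 ∸ 4       ≡⟨ cong (_∸ 4) (+-comm m 2) ⟩
  2 + m ∸ (2 + 2) ≡⟨ [m+n]∸[m+o]≡n∸o 2 m 2 ⟩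
  m ∸ 2           ∎
  where open ≤-Reasoning

theorem1p1 : ∀ (p : ℕ) → Prime p → 11 ≤ p →
    P≤ p 3 ((p ∸ 1) ! ∸ ((p + 2) / 3) + 2)
    × ((p ∸ 1) ! ∸ ((p + 2) / 3) + 2 ≤ (p ∸ 1) ! ∸ 2)
theorem1p1 (suc (suc k)) p-prime 11≤p = code-bound , m∸n+2≤m∸2 (suc k !) ((p + 2) / 3) 4≤N 4≤c
  where
  p = 2 + k
  3≤k : 3 ≤ k
  3≤k = ≤-trans (s≤s (s≤s (s≤s z≤n))) (s≤s⁻¹ (s≤s⁻¹ 11≤p))
  4≤c : 4 ≤ (p + 2) / 3
  4≤c = /-monoˡ-≤ 3 (+-monoˡ-≤ 2 11≤p)
  4≤N : 4 ≤ suc k !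
  4≤N = ≤-trans (s≤s 3≤k) (m≤m*n (suc k) (k !) {{k !≢0}})
  code-bound : P≤ p 3 (suc k ! ∸ ((p + 2) / 3) + 2)
  code-bound C code@(perms , _) = 3L+p≤3[N+1]⇒L≤N∸⌈p/3⌉+2 (length C) (suc k !) p
    (subst (λ L → 3 * L + p ≤ 3 * (suc k ! + 1)) (sym (length≡∑zeros-at perms))
      (averaging-bound k (zeros-at C) (suc k !) 3≤k (Wilson.p∣[p-1]!+1 k p-prime) (row-bound k code)))
    where open Balls (suc k)
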